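{- Let $G$ be an orientation of a chordal graph with no induced copy of $\vec{C}_3\Rightarrow K_1$, and suppose $\vec{\chi}(G)=k$. Then there exists a digraph $F$, which is also an orientation of a chordal graph with no induced copy of $\vec{C}_3\Rightarrow K_1$, such that $\vec{\chi}(F)=k$ and, for every $k$-dicolouring of $F$, $F$ contains a transitive subtournament on $k$ vertices whose vertices receive pairwise distinct colours.
   Context: All digraphs are finite and simple (no loops, no parallel arcs, no digons). An orientation of a chordal graph is a digraph whose underlying undirected graph has no induced cycle of length at least $4$. $\vec{C}_3\Rightarrow K_1$ is the digraph consisting of a directed triangle together with a fourth vertex that is an out-neighbour of all three triangle vertices. A $k$-dicolouring of a digraph $G$ is a map $c:V(G)\to\{1,\dots,k\}$ such that each colour class induces an acyclic subdigraph; $\vec{\chi}(G)$ is the least $k$ admitting a $k$-dicolouring. A transitive subtournament is a set of pairwise adjacent vertices inducing an acyclic subdigraph. -}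

module Defs where

open import Data.Nat using (ℕ; zero; suc; _≤_; _<_)
open import Data.Fin using (Fin; zero; suc; inject₁; fromℕ)
open import Data.Bool using (Bool; true; false; T)
open import Data.Product using (Σ; _×_; _,_; ∃)
open import Data.Sum using (_⊎_)
open import Data.Empty using (⊥)
open import Relation.Nullary using (¬_)
open import Relation.Binary.PropositionalEquality using (_≡_; _≢_)
open import Function.Definitions using (Injective)

record Digraph : Set where
  field
    n       : ℕ
    arc     : Fin n → Fin n → Bool
    noLoop  : ∀ v → arc v v ≡ false
    noDigon : ∀ u v → T (arc u v) → arc v u ≡ false
open Digraph public

Vertex : Digraph → Set
Vertex G = Fin (n G)

Arc : (G : Digraph) → Vertex G → Vertex G → Set
Arc G u v = T (arc G u v)

Adj : (G : Digraph) → Vertex G → Vertex G → Set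
Adj G u v = Arc G u v ⊎ Arc G v u

-- cyclic successor on Fin (suc m): i ↦ i+1, last ↦ 0
next : ∀ {m} → Fin (suc m) → Fin (suc m)
next {zero}  zero    = zero
next {suc m} zero    = suc zero
next {suc m} (suc i) with next {m} i
... | zero  = zero
... | suc j = suc (suc j)

Consecutive : ∀ {m} → Fin (suc m) → Fin (suc m) → Set
Consecutive i j = (next i ≡ j) ⊎ (next j ≡ i)

-- An induced cycle of length suc m (≥ 4 required below) in the underlying
-- undirected graph: distinct vertices, consecutive ones adjacent,
-- non-consecutive ones non-adjacent.
record InducedCycle (G : Digraph) (m : ℕ) : Set where
  field
    vtx      : Fin (suc m) → Vertex G
    distinct : Injective _≡_ _≡_ vtx
    edges    : ∀ i → Adj G (vtx i) (vtx (next i))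
    chordless : ∀ i j → i ≢ j → ¬ Consecutive i j → ¬ Adj G (vtx i) (vtx j)

IsChordalOrientation : Digraph → Set
IsChordalOrientation G = ∀ m → 3 ≤ m → ¬ InducedCycle G m

-- Induced copy of C⃗₃ ⇒ K₁ : distinct a, b, c, d with a→b→c→a and
-- a→d, b→d, c→d.  (All pairs are adjacent in the pattern and G has no
-- digons, so this is exactly an induced subdigraph isomorphic to it.)
record InducedC3toK1 (G : Digraph) : Set where
  field
    a b c d : Vertex G
    ab : Arc G a b
    bc : Arc G b c
    ca : Arc G c a
    ad : Arc G a d
    bd : Arc G b d
    cd : Arc G c d
    a≢b : a ≢ b
    a≢c : a ≢ c
    a≢d : a ≢ d
    b≢c : b ≢ c
    b≢d : b ≢ d
    c≢d : c ≢ d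

C3toK1Free : Digraph → Set
C3toK1Free G = ¬ InducedC3toK1 G

record DirectedCycleIn (G : Digraph) (P : Vertex G → Set) (m : ℕ) : Set where
  field
    vtx      : Fin (suc m) → Vertex G
    distinct : Injective _≡_ _≡_ vtx
    arcs     : ∀ i → Arc G (vtx i) (vtx (next i))
    inside   : ∀ i → P (vtx i)

Acyclic : (G : Digraph) → (Vertex G → Set) → Set
Acyclic G P = ∀ m → ¬ DirectedCycleIn G P m

IsDicolouring : (G : Digraph) (k : ℕ) → (Vertex G → Fin k) → Set
IsDicolouring G k col = ∀ (x : Fin k) → Acyclic G (λ v → col v ≡ x)

Dicolourable : Digraph → ℕ → Set
Dicolourable G k = Σ (Vertex G → Fin k) (IsDicolouring G k)

DichromaticNumber : Digraph → ℕ → Set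
DichromaticNumber G k = Dicolourable G k × (∀ j → Dicolourable G j → k ≤ j)

record ColourfulTransitiveTournament (G : Digraph) (k : ℕ)
         (col : Vertex G → Fin k) : Set where
  field
    vtx       : Fin k → Vertex G
    distinct  : Injective _≡_ _≡_ vtx
    adjacent  : ∀ i j → i ≢ j → Adj G (vtx i) (vtx j)
    acyclic   : Acyclic G (λ v → ∃ λ i → vtx i ≡ v)
    rainbow   : Injective _≡_ _≡_ (λ i → col (vtx i))

{-# OPTIONS --safe #-}
module Submission where

-- Take F = F_k, where F_0 is empty and F_{j+1} is G with, below each vertex v, a
-- fresh copy of F_j dominated by v.  Every arc of F_{j+1} lies in G, lies in one
-- copy, or goes from a vertex to its own copy, so a chordless cycle, an induced
-- C⃗₃ ⇒ K₁ or a directed cycle of F_{j+1} lives in G or in a single copy.  Hence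
-- F_k is chordal, C⃗₃ ⇒ K₁-free and k-dicolourable, and χ⃗(F_k) ≥ χ⃗(G) = k since
-- G ⊆ F_k.  In a k-dicolouring of F_k every colour appears on G (as χ⃗(G) = k);
-- taking a vertex v of G with the first colour and recursing in the copy below v,
-- which v dominates, builds a transitive tournament coloured 1, 2, …, k.

open import Defs
open import Data.Nat using (ℕ; zero; suc; _+_; _*_; _∸_; _≤_; _<_; z≤n; s≤s)
open import Data.Nat.Properties
  using (suc-injective; n≤1+n; ≤-refl; ≤-trans; <⇒≤; <-irrefl; <-≤-trans; ≤-<-connex; +-comm;
         +-monoˡ-≤; +-cancelʳ-<; m<n+m; n<1+n; m∸n+n≡m; module ≤-Reasoning)
open import Data.Fin using (Fin; zero; suc; toℕ; punchOut; combine; remQuot)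
open import Data.Fin.Properties
  using (¬Fin0; toℕ-injective; toℕ≤pred[n]; toℕ<n; remQuot-combine; combine-surjective;
         combine-injectiveˡ; combine-injectiveʳ; any?; punchOut-injective; <-cmp; _≟_)
open import Data.Bool using (Bool; false; T; _∧_)
open import Data.Bool.Properties using (∧-zeroʳ; T-∧; T-≡)
open import Data.Empty using (⊥-elim)
open import Data.Product using (Σ; ∃; _×_; _,_; proj₁; proj₂)
open import Data.Sum using (_⊎_; inj₁; inj₂)
import Data.Sum as Sum
import Data.Fin.Properties as Fin
open import Function using (_∘_; id)
open import Function.Bundles using (Equivalence)
open import Function.Definitions using (Injective)
open import Relation.Binary using (tri<; tri≈; tri>)
open import Relation.Nullary using (¬_; yes; no)
open import Relation.Nullary.Decidable using (⌊_⌋; toWitness; fromWitness)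
open import Relation.Binary.PropositionalEquality
import Function.Endo.Propositional as Endo

module _ {m : ℕ} where
  open Endo (Fin (suc m)) public using (_^_; ^-homo)

toℕ-next : ∀ {m} (i : Fin (suc m)) → toℕ i < m → toℕ (next i) ≡ suc (toℕ i)
toℕ-next {suc m} zero    _       = refl
toℕ-next {suc m} (suc i) (s≤s p) with next {m} i | toℕ-next {m} i p
... | suc j | e = cong suc e

next-last : ∀ {m} (i : Fin (suc m)) → toℕ i ≡ m → next i ≡ zero
next-last {zero}  zero    _ = refl
next-last {suc m} (suc i) p with next {m} i | next-last {m} i (suc-injective p)
... | zero | _ = refl

next^-+ : ∀ {m} a b (i : Fin (suc m)) → (next ^ (a + b)) i ≡ (next ^ a) ((next ^ b) i)
next^-+ a b i = cong-app (^-homo next a b) i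

toℕ-next^ : ∀ {m} k → k ≤ m → toℕ ((next {m} ^ k) zero) ≡ k
toℕ-next^ zero    _   = refl
toℕ-next^ {m} (suc k) k<m = trans (toℕ-next _ (subst (_< m) (sym ih) k<m)) (cong suc ih)
  where ih = toℕ-next^ k (<⇒≤ k<m)

next^-toℕ : ∀ {m} (i : Fin (suc m)) → (next ^ toℕ i) zero ≡ i
next^-toℕ i = toℕ-injective (toℕ-next^ (toℕ i) (toℕ≤pred[n] i))

next^-period : ∀ {m} → (next {m} ^ suc m) zero ≡ zero
next^-period {m} = next-last _ (toℕ-next^ m ≤-refl)

next^-reaches : ∀ {m} (i j : Fin (suc m)) → ∃ λ k → (next ^ k) i ≡ j
next^-reaches {m} i j = toℕ j + (suc m ∸ toℕ i) , (begin
  (next ^ (toℕ j + (suc m ∸ toℕ i))) i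
    ≡⟨ next^-+ (toℕ j) _ i ⟩
  (next ^ toℕ j) ((next ^ (suc m ∸ toℕ i)) i)
    ≡⟨ cong ((next ^ toℕ j) ∘ (next ^ (suc m ∸ toℕ i))) (sym (next^-toℕ i)) ⟩
  (next ^ toℕ j) ((next ^ (suc m ∸ toℕ i)) ((next ^ toℕ i) zero))
    ≡⟨ cong (next ^ toℕ j) (sym (next^-+ (suc m ∸ toℕ i) (toℕ i) zero)) ⟩
  (next ^ toℕ j) ((next ^ (suc m ∸ toℕ i + toℕ i)) zero)
    ≡⟨ cong (λ k → (next ^ toℕ j) ((next ^ k) zero)) (m∸n+n≡m (<⇒≤ (toℕ<n i))) ⟩
  (next ^ toℕ j) ((next ^ suc m) zero)
    ≡⟨ cong (next ^ toℕ j) next^-period ⟩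
  (next ^ toℕ j) zero
    ≡⟨ next^-toℕ j ⟩
  j ∎)
  where open ≡-Reasoning

-- The index of next^(k+t) 0 is k+t if k+t ≤ m, and k+t-(m+1) < t otherwise.
toℕ-next^-+-≢ : ∀ {m} k t → 0 < k → k ≤ m → t ≤ m → toℕ ((next {m} ^ (k + t)) zero) ≢ t
toℕ-next^-+-≢ {m} k t 0<k k≤m t≤m eq with ≤-<-connex (k + t) m
... | inj₁ k+t≤m = <-irrefl (trans (sym eq) (toℕ-next^ (k + t) k+t≤m)) (m<n+m t 0<k)
... | inj₂ m<k+t = <-irrefl (trans (sym (toℕ-next^ r r≤m)) (trans (cong toℕ wrap) eq)) r<t
  where
    r = k + t ∸ suc m
    r+m+1≡k+t : r + suc m ≡ k + t
    r+m+1≡k+t = m∸n+n≡m m<k+t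
    r<t : r < t
    r<t = +-cancelʳ-< (suc m) r t (begin-strict
      r + suc m ≡⟨ r+m+1≡k+t ⟩
      k + t     ≤⟨ +-monoˡ-≤ t k≤m ⟩
      m + t     <⟨ n<1+n (m + t) ⟩
      suc m + t ≡⟨ +-comm (suc m) t ⟩
      t + suc m ∎)
      where open ≤-Reasoning
    r≤m : r ≤ m
    r≤m = ≤-trans (<⇒≤ r<t) t≤m
    wrap : (next ^ r) zero ≡ (next ^ (k + t)) zero
    wrap = begin
      (next ^ r) zero                  ≡⟨ cong (next ^ r) next^-period ⟨
      (next ^ r) ((next ^ suc m) zero) ≡⟨ next^-+ r (suc m) zero ⟨
      (next ^ (r + suc m)) zero        ≡⟨ cong (λ j → (next ^ j) zero) r+m+1≡k+t ⟩
      (next ^ (k + t)) zero            ∎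
      where open ≡-Reasoning

next^-≢ : ∀ {m} k → 0 < k → k ≤ m → (q : Fin (suc m)) → (next ^ k) q ≢ q
next^-≢ k 0<k k≤m q eq = toℕ-next^-+-≢ k (toℕ q) 0<k k≤m (toℕ≤pred[n] q) (cong toℕ (begin
  (next ^ (k + toℕ q)) zero         ≡⟨ next^-+ k (toℕ q) zero ⟩
  (next ^ k) ((next ^ toℕ q) zero)  ≡⟨ cong (next ^ k) (next^-toℕ q) ⟩
  (next ^ k) q                      ≡⟨ eq ⟩
  q                                 ∎))
  where open ≡-Reasoning

next²-≢ : ∀ {m} → 2 ≤ m → (q : Fin (suc m)) → q ≢ next (next q)
next²-≢ 2≤m q eq = next^-≢ 2 (s≤s z≤n) 2≤m q (sym eq)

next²-¬Consecutive : ∀ {m} → 3 ≤ m → (q : Fin (suc m)) → ¬ Consecutive q (next (next q))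
next²-¬Consecutive 3≤m q (inj₁ eq) =
  next^-≢ 1 (s≤s z≤n) (≤-trans (s≤s z≤n) 3≤m) (next q) (sym eq)
next²-¬Consecutive 3≤m q (inj₂ eq) = next^-≢ 3 (s≤s z≤n) 3≤m q eq

module _ {m : ℕ} {P : Fin (suc m) → Set} where

  next^-preserves : (∀ i → P i → P (next i)) → ∀ k {i} → P i → P ((next ^ k) i)
  next^-preserves step zero    p = p
  next^-preserves step (suc k) p = step _ (next^-preserves step k p)

  next^-reflects : (∀ i → P (next i) → P i) → ∀ k {i} → P ((next ^ k) i) → P i
  next^-reflects step zero    p = p
  next^-reflects step (suc k) p = next^-reflects step k (step _ p)

  cyclic-induction : (∀ i → P i → P (next i)) → ∀ {i₀} → P i₀ → ∀ j → P j
  cyclic-induction step {i₀} p j with next^-reaches i₀ j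
  ... | k , refl = next^-preserves step k p

  cyclic-induction⁻ : (∀ i → P (next i) → P i) → ∀ {i₀} → P i₀ → ∀ j → P j
  cyclic-induction⁻ step {i₀} p j with next^-reaches j i₀
  ... | k , refl = next^-reflects step k p

¬increasing-around-cycle : ∀ {m} (h : Fin (suc m) → ℕ) → ¬ (∀ i → h i < h (next i))
¬increasing-around-cycle h increasing =
  <-irrefl refl (<-≤-trans (increasing zero) (cyclic-induction {P = λ j → h (next zero) ≤ h j}
    (λ i le → ≤-trans le (<⇒≤ (increasing i))) ≤-refl zero))

arc-irrefl : (G : Digraph) (v : Vertex G) → ¬ Arc G v v
arc-irrefl G v t = subst T (noLoop G v) t

arc-asym : (G : Digraph) {u v : Vertex G} → Arc G u v → ¬ Arc G v u
arc-asym G {u} {v} t t′ = subst T (noDigon G u v t) t′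

directedCycle-weaken : ∀ {G} {P Q : Vertex G → Set} {m} →
  (∀ {v} → P v → Q v) → DirectedCycleIn G P m → DirectedCycleIn G Q m
directedCycle-weaken P⇒Q C = record
  { vtx = vtx ; distinct = distinct ; arcs = arcs ; inside = P⇒Q ∘ inside }
  where open DirectedCycleIn C

IsDicolouring-resp-≗ : ∀ {G k} {c c′ : Vertex G → Fin k} →
  (∀ v → c v ≡ c′ v) → IsDicolouring G k c → IsDicolouring G k c′
IsDicolouring-resp-≗ c≗c′ dc x m C = dc x m (directedCycle-weaken (λ {v} → trans (c≗c′ v)) C)

-- If some colour were missing, punching it out would give a (k-1)-dicolouring.
dicolouring-surjective : ∀ {G k} {col : Vertex G → Fin k} →
  (∀ j → Dicolourable G j → k ≤ j) → IsDicolouring G k col → ∀ x → ∃ λ v → col v ≡ x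
dicolouring-surjective {k = zero} _ _ ()
dicolouring-surjective {G} {suc k} {col} minimal dc x with any? (λ v → col v ≟ x)
... | yes hit  = hit
... | no  miss = ⊥-elim (<-irrefl refl (minimal k (squeezed , squeezed-dicolouring)))
  where
    avoids : ∀ v → x ≢ col v
    avoids v eq = miss (v , sym eq)
    squeezed : Vertex G → Fin k
    squeezed v = punchOut (avoids v)
    squeezed-dicolouring : IsDicolouring G k squeezed
    squeezed-dicolouring y m C = dc (col (vtx zero)) m (directedCycle-weaken
      (λ {v} eq → punchOut-injective (avoids v) (avoids (vtx zero)) (trans eq (sym (inside zero)))) C)
      where open DirectedCycleIn C

record Embedding (A B : Digraph) : Set where
  field
    map       : Vertex A → Vertex B
    injective : Injective _≡_ _≡_ map
    arc-map   : ∀ u v → arc B (map u) (map v) ≡ arc A u v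

module _ {A B : Digraph} (e : Embedding A B) where
  open Embedding e

  Image : Vertex B → Set
  Image x = ∃ λ u → map u ≡ x

  arc-preserve : ∀ {u v} → Arc A u v → Arc B (map u) (map v)
  arc-preserve {u} {v} = subst T (sym (arc-map u v))

  arc-reflect : ∀ {x y} (p : Image x) (q : Image y) → Arc B x y → Arc A (proj₁ p) (proj₁ q)
  arc-reflect (u , refl) (v , refl) = subst T (arc-map u v)

  adj-preserve : ∀ {x y} (p : Image x) (q : Image y) → Adj A (proj₁ p) (proj₁ q) → Adj B x y
  adj-preserve (u , refl) (v , refl) = Sum.map arc-preserve arc-preserve

  adj-reflect : ∀ {x y} (p : Image x) (q : Image y) → Adj B x y → Adj A (proj₁ p) (proj₁ q)
  adj-reflect p q = Sum.map (arc-reflect p q) (arc-reflect q p)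

  preimage-≡ : ∀ {x y} (p : Image x) (q : Image y) → proj₁ p ≡ proj₁ q → x ≡ y
  preimage-≡ (u , refl) (v , refl) = cong map

  preimage-injective : ∀ {x y} (p : Image x) (q : Image y) → x ≡ y → proj₁ p ≡ proj₁ q
  preimage-injective (u , refl) (v , refl) = injective

  dicolouring-comap : ∀ {k col} → IsDicolouring B k col → IsDicolouring A k (col ∘ map)
  dicolouring-comap dc x m C = dc x m record
    { vtx = map ∘ vtx ; distinct = distinct ∘ injective ; arcs = arc-preserve ∘ arcs ; inside = inside }
    where open DirectedCycleIn C

  dicolourable-comap : ∀ {k} → Dicolourable B k → Dicolourable A k
  dicolourable-comap (col , dc) = col ∘ map , dicolouring-comap dc

  preimage-directedCycle : ∀ {P m} (C : DirectedCycleIn B P m) →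
    (∀ i → Image (DirectedCycleIn.vtx C i)) → DirectedCycleIn A (P ∘ map) m
  preimage-directedCycle {P} C im = record
    { vtx      = λ i → proj₁ (im i)
    ; distinct = λ {i} {j} eq → distinct (preimage-≡ (im i) (im j) eq)
    ; arcs     = λ i → arc-reflect (im i) (im (next i)) (arcs i)
    ; inside   = λ i → subst P (sym (proj₂ (im i))) (inside i) }
    where open DirectedCycleIn C

  preimage-inducedCycle : ∀ {m} (C : InducedCycle B m) →
    (∀ i → Image (InducedCycle.vtx C i)) → InducedCycle A m
  preimage-inducedCycle C im = record
    { vtx       = λ i → proj₁ (im i)
    ; distinct  = λ {i} {j} eq → distinct (preimage-≡ (im i) (im j) eq)
    ; edges     = λ i → adj-reflect (im i) (im (next i)) (edges i)
    ; chordless = λ i j i≢j apart adj → chordless i j i≢j apart (adj-preserve (im i) (im j) adj) }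
    where open InducedCycle C

  preimage-C3toK1 : (D : InducedC3toK1 B) → let open InducedC3toK1 D in
    Image a → Image b → Image c → Image d → InducedC3toK1 A
  preimage-C3toK1 D pa pb pc pd = record
    { ab = arc-reflect pa pb ab ; bc = arc-reflect pb pc bc ; ca = arc-reflect pc pa ca
    ; ad = arc-reflect pa pd ad ; bd = arc-reflect pb pd bd ; cd = arc-reflect pc pd cd
    ; a≢b = a≢b ∘ preimage-≡ pa pb ; a≢c = a≢c ∘ preimage-≡ pa pc
    ; a≢d = a≢d ∘ preimage-≡ pa pd ; b≢c = b≢c ∘ preimage-≡ pb pc
    ; b≢d = b≢d ∘ preimage-≡ pb pd ; c≢d = c≢d ∘ preimage-≡ pc pd }
    where open InducedC3toK1 D

record OrderedTournament (D : Digraph) {k j : ℕ}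
         (col : Vertex D → Fin k) (τ : Fin j → Fin k) : Set where
  field
    vtx     : Fin j → Vertex D
    ordered : ∀ {a b} → toℕ a < toℕ b → Arc D (vtx a) (vtx b)
    colours : ∀ a → col (vtx a) ≡ τ a

ordered⇒colourful : ∀ {D k} {col : Vertex D → Fin k} →
  OrderedTournament D col id → ColourfulTransitiveTournament D k col
ordered⇒colourful {D} {k} {col} T = record
  { vtx = vtx ; distinct = rainbow ∘ cong col ; adjacent = adjacent
  ; acyclic = acyclic ; rainbow = rainbow }
  where
    open OrderedTournament T
    rainbow : Injective _≡_ _≡_ (col ∘ vtx)
    rainbow {a} {b} eq = trans (sym (colours a)) (trans eq (colours b))
    adjacent : ∀ a b → a ≢ b → Adj D (vtx a) (vtx b)
    adjacent a b a≢b with <-cmp a b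
    ... | tri< a<b _ _ = inj₁ (ordered a<b)
    ... | tri≈ _ a≡b _ = ⊥-elim (a≢b a≡b)
    ... | tri> _ _ b<a = inj₂ (ordered b<a)
    ordered⁻ : ∀ {a b} → Arc D (vtx a) (vtx b) → toℕ a < toℕ b
    ordered⁻ {a} {b} t with <-cmp a b
    ... | tri< a<b _ _ = a<b
    ... | tri≈ _ refl _ = ⊥-elim (arc-irrefl D (vtx a) t)
    ... | tri> _ _ b<a = ⊥-elim (arc-asym D t (ordered b<a))
    acyclic : Acyclic D (λ v → ∃ λ a → vtx a ≡ v)
    acyclic m C = ¬increasing-around-cycle (toℕ ∘ index) λ i →
      ordered⁻ (subst₂ (Arc D) (sym (proj₂ (inside i))) (sym (proj₂ (inside (next i)))) (arcs i))
      where
        open DirectedCycleIn C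
        index : Fin (suc m) → Fin k
        index i = proj₁ (inside i)

-- Position (v , zero) is the vertex v of G, and (v , suc w) is the vertex w of the
-- copy of H below v; v dominates its copy, and nothing else meets the copy.
module Attach (G H : Digraph) where

  Position : Set
  Position = Fin (n G) × Fin (suc (n H))

  arcₚ : Position → Position → Bool
  arcₚ (v , zero)  (u , zero)   = arc G v u
  arcₚ (v , zero)  (u , suc _)  = ⌊ v ≟ u ⌋
  arcₚ (_ , suc _) (_ , zero)   = false
  arcₚ (v , suc w) (u , suc w′) = ⌊ v ≟ u ⌋ ∧ arc H w w′

  arcₚ-irrefl : ∀ p → arcₚ p p ≡ false
  arcₚ-irrefl (v , zero)  = noLoop G v
  arcₚ-irrefl (v , suc w) rewrite noLoop H w = ∧-zeroʳ _

  arcₚ-asym : ∀ p q → T (arcₚ p q) → arcₚ q p ≡ false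
  arcₚ-asym (v , zero)  (u , zero)   t = noDigon G v u t
  arcₚ-asym (v , zero)  (u , suc w)  t = refl
  arcₚ-asym (v , suc w) (u , suc w′) t
    rewrite noDigon H w w′ (proj₂ (Equivalence.to T-∧ t)) = ∧-zeroʳ _

  attach : Digraph
  attach = record
    { n       = n G * suc (n H)
    ; arc     = λ x y → arcₚ (remQuot (suc (n H)) x) (remQuot (suc (n H)) y)
    ; noLoop  = λ x → arcₚ-irrefl (remQuot (suc (n H)) x)
    ; noDigon = λ x y → arcₚ-asym (remQuot (suc (n H)) x) (remQuot (suc (n H)) y) }

  arc-combine : ∀ v i u j → arc attach (combine v i) (combine u j) ≡ arcₚ (v , i) (u , j)
  arc-combine v i u j = cong₂ arcₚ (remQuot-combine v i) (remQuot-combine u j)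

  root : Vertex G → Vertex attach
  root v = combine v zero

  copy : Vertex G → Vertex H → Vertex attach
  copy v w = combine v (suc w)

  rootEmbedding : Embedding G attach
  rootEmbedding = record
    { map = root
    ; injective = λ eq → combine-injectiveˡ _ zero _ zero eq
    ; arc-map = λ v u → arc-combine v zero u zero }

  copyEmbedding : Vertex G → Embedding H attach
  copyEmbedding v = record
    { map = copy v
    ; injective = λ eq → Fin.suc-injective (combine-injectiveʳ v _ v _ eq)
    ; arc-map = λ w w′ → trans (arc-combine v (suc w) v (suc w′))
                               (cong (_∧ arc H w w′) (Equivalence.to T-≡ (fromWitness refl))) }

  IsRoot : Vertex attach → Set
  IsRoot = Image rootEmbedding

  InCopy : Vertex G → Vertex attach → Set
  InCopy v = Image (copyEmbedding v)

  classify : ∀ x → IsRoot x ⊎ ∃ λ v → InCopy v x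
  classify x with combine-surjective {n G} {suc (n H)} x
  ... | v , zero  , eq = inj₁ (v , eq)
  ... | v , suc w , eq = inj₂ (v , w , eq)

  root⇒copy : ∀ {v w} → Arc attach (root v) (copy v w)
  root⇒copy {v} {w} = subst T (sym (arc-combine v zero v (suc w))) (fromWitness refl)

  root⇒copy⁻ : ∀ {u v w} → Arc attach (root u) (copy v w) → u ≡ v
  root⇒copy⁻ {u} {v} {w} t = toWitness (subst T (arc-combine u zero v (suc w)) t)

  ¬copy⇒root : ∀ {v w u} → ¬ Arc attach (copy v w) (root u)
  ¬copy⇒root {v} {w} {u} t = subst T (arc-combine v (suc w) u zero) t

  copy⇒copy⁻ : ∀ {u w v w′} → Arc attach (copy u w) (copy v w′) → u ≡ v
  copy⇒copy⁻ {u} {w} {v} {w′} t =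
    toWitness {a? = u ≟ v}
      (proj₁ (Equivalence.to (T-∧ {⌊ u ≟ v ⌋}) (subst T (arc-combine u (suc w) v (suc w′)) t)))

  copy-out : ∀ {v x y} → Arc attach x y → InCopy v x → InCopy v y
  copy-out {y = y} t (w , refl) with classify y
  ... | inj₁ (u , refl) = ⊥-elim (¬copy⇒root t)
  ... | inj₂ (u , w′ , refl) with refl ← copy⇒copy⁻ t = w′ , refl

  root-in : ∀ {x y} → Arc attach x y → IsRoot y → IsRoot x
  root-in {x} t (u , refl) with classify x
  ... | inj₁ p = p
  ... | inj₂ (v , w , refl) = ⊥-elim (¬copy⇒root t)

  root-into-copy : ∀ {v x y} → Arc attach x y → IsRoot x → InCopy v y → x ≡ root v
  root-into-copy t (u , refl) (w , refl) = cong root (root⇒copy⁻ t)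

  copy-neighbour : ∀ {v x y} → Adj attach x y → InCopy v y → x ≡ root v ⊎ InCopy v x
  copy-neighbour (inj₂ t) p = inj₂ (copy-out t p)
  copy-neighbour {x = x} (inj₁ t) p@(_ , refl) with classify x
  ... | inj₁ r = inj₁ (root-into-copy t r p)
  ... | inj₂ (u , q@(_ , refl)) with refl ← copy⇒copy⁻ t = inj₂ q

  -- A copy vertex on an induced cycle has its two cycle neighbours in the same copy:
  -- otherwise one of them is the root, adjacent to the other, which is a chord.
  attach-chordal : IsChordalOrientation G → IsChordalOrientation H → IsChordalOrientation attach
  attach-chordal chordalG chordalH m 3≤m C =
    chordalG m 3≤m (preimage-inducedCycle rootEmbedding C all-roots)
    where
      open InducedCycle C renaming (vtx to c)
      2≤m : 2 ≤ m
      2≤m = ≤-trans (n≤1+n 2) 3≤m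
      copy-spreads-back : ∀ v q → InCopy v (c (next q)) → InCopy v (c q)
      copy-spreads-back v q p
        with copy-neighbour (edges q) p | copy-neighbour (Sum.swap (edges (next q))) p
      ... | inj₂ p′ | _ = p′
      ... | inj₁ e | inj₁ e′ = ⊥-elim (next²-≢ 2≤m q (distinct (trans e (sym e′))))
      ... | inj₁ e | inj₂ (w , e′) = ⊥-elim (chordless q (next (next q)) (next²-≢ 2≤m q)
              (next²-¬Consecutive 3≤m q) (inj₁ (subst₂ (Arc attach) (sym e) e′ root⇒copy)))
      not-in-copy : ∀ v i → ¬ InCopy v (c i)
      not-in-copy v i p =
        chordalH m 3≤m
          (preimage-inducedCycle (copyEmbedding v) C (cyclic-induction⁻ (copy-spreads-back v) p))
      all-roots : ∀ i → IsRoot (c i)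
      all-roots i with classify (c i)
      ... | inj₁ p       = p
      ... | inj₂ (v , p) = ⊥-elim (not-in-copy v i p)

  -- If d lies in a copy, both a and b are its root, contradicting a ≢ b.
  attach-C3toK1Free : C3toK1Free G → C3toK1Free H → C3toK1Free attach
  attach-C3toK1Free freeG freeH D with classify (InducedC3toK1.a D) | classify (InducedC3toK1.d D)
  ... | inj₂ (v , pa) | _ = freeH (preimage-C3toK1 (copyEmbedding v) D pa pb pc pd)
    where
      open InducedC3toK1 D
      pb = copy-out ab pa
      pc = copy-out bc pb
      pd = copy-out ad pa
  ... | inj₁ pa | inj₁ pd = freeG (preimage-C3toK1 rootEmbedding D pa pb pc pd)
    where
      open InducedC3toK1 D
      pc = root-in ca pa
      pb = root-in bc pc
  ... | inj₁ pa | inj₂ (v , pd) = a≢b (trans (root-into-copy ad pa pd) (sym (root-into-copy bd pb pd)))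
    where
      open InducedC3toK1 D
      pb = root-in bc (root-in ca pa)

  -- A directed cycle through a copy stays in it, and one through a root consists of roots.
  attach-dicolouring : ∀ {k} (col : Vertex attach → Fin k) →
    IsDicolouring G k (col ∘ root) → (∀ v → IsDicolouring H k (col ∘ copy v)) →
    IsDicolouring attach k col
  attach-dicolouring col dG dH x m C with classify (DirectedCycleIn.vtx C zero)
  ... | inj₁ p       = dG x m (preimage-directedCycle rootEmbedding C
                         (cyclic-induction⁻ (λ i → root-in (DirectedCycleIn.arcs C i)) p))
  ... | inj₂ (v , p) = dH v x m (preimage-directedCycle (copyEmbedding v) C
                         (cyclic-induction (λ i → copy-out (DirectedCycleIn.arcs C i)) p))

  attach-dicolourable : ∀ {k} → Dicolourable G k → Dicolourable H k → Dicolourable attach k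
  attach-dicolourable {k} (cG , dG) (cH , dH) =
    col , attach-dicolouring col (IsDicolouring-resp-≗ (sym ∘ col-root) dG)
                                 (λ v → IsDicolouring-resp-≗ (sym ∘ col-copy v) dH)
    where
      colₚ : Position → Fin k
      colₚ (v , zero)  = cG v
      colₚ (v , suc w) = cH w
      col : Vertex attach → Fin k
      col x = colₚ (remQuot (suc (n H)) x)
      col-root : ∀ v → col (root v) ≡ cG v
      col-root v = cong colₚ (remQuot-combine v zero)
      col-copy : ∀ v w → col (copy v w) ≡ cH w
      col-copy v w = cong colₚ (remQuot-combine v (suc w))

  extend-ordered : ∀ {k j} {col : Vertex attach → Fin k} {τ : Fin (suc j) → Fin k} v →
    col (root v) ≡ τ zero → OrderedTournament H (col ∘ copy v) (τ ∘ suc) →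
    OrderedTournament attach col τ
  extend-ordered {col = col} {τ} v root-colour T =
    record { vtx = vtx′ ; ordered = ordered′ ; colours = colours′ }
    where
      open OrderedTournament T
      vtx′ : Fin (suc _) → Vertex attach
      vtx′ zero    = root v
      vtx′ (suc a) = copy v (vtx a)
      ordered′ : ∀ {a b} → toℕ a < toℕ b → Arc attach (vtx′ a) (vtx′ b)
      ordered′ {zero}  {suc b} _       = root⇒copy
      ordered′ {suc a} {suc b} (s≤s p) = arc-preserve (copyEmbedding v) (ordered p)
      colours′ : ∀ a → col (vtx′ a) ≡ τ a
      colours′ zero    = root-colour
      colours′ (suc a) = colours a

emptyDigraph : Digraph
emptyDigraph = record { n = 0 ; arc = λ () ; noLoop = λ () ; noDigon = λ () }

module Tower (G : Digraph) where
  open Attach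

  tower : ℕ → Digraph
  tower zero    = emptyDigraph
  tower (suc j) = attach G (tower j)

  tower-chordal : IsChordalOrientation G → ∀ j → IsChordalOrientation (tower j)
  tower-chordal chordalG zero    m _ C = ¬Fin0 (InducedCycle.vtx C zero)
  tower-chordal chordalG (suc j) = attach-chordal G (tower j) chordalG (tower-chordal chordalG j)

  tower-C3toK1Free : C3toK1Free G → ∀ j → C3toK1Free (tower j)
  tower-C3toK1Free freeG zero    D = ¬Fin0 (InducedC3toK1.a D)
  tower-C3toK1Free freeG (suc j) = attach-C3toK1Free G (tower j) freeG (tower-C3toK1Free freeG j)

  tower-dicolourable : ∀ {k} → Dicolourable G k → ∀ j → Dicolourable (tower j) k
  tower-dicolourable dG zero    = (λ ()) , λ _ _ C → ¬Fin0 (DirectedCycleIn.vtx C zero)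
  tower-dicolourable dG (suc j) = attach-dicolourable G (tower j) dG (tower-dicolourable dG j)

  tower-lowerBound : ∀ {k} → (∀ i → Dicolourable G i → k ≤ i) →
    ∀ i → Dicolourable (tower k) i → k ≤ i
  tower-lowerBound {zero}  _       i _  = z≤n
  tower-lowerBound {suc k} minimal i dF = minimal i (dicolourable-comap (rootEmbedding G (tower k)) dF)

  -- Any colour sequence τ is realised: τ(0) appears on some root v since
  -- χ⃗(G) ≥ k, and the rest of τ is realised inside the copy hanging from v.
  tower-ordered : ∀ {k} → (∀ i → Dicolourable G i → k ≤ i) →
    ∀ j (col : Vertex (tower j) → Fin k) → IsDicolouring (tower j) k col →
    (τ : Fin j → Fin k) → OrderedTournament (tower j) col τ
  tower-ordered minimal zero    col dc τ =
    record { vtx = λ () ; ordered = λ {a} → ⊥-elim (¬Fin0 a) ; colours = λ () }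
  tower-ordered minimal (suc j) col dc τ =
    extend-ordered G (tower j) v root-colour
      (tower-ordered minimal j (col ∘ copy G (tower j) v)
        (dicolouring-comap (copyEmbedding G (tower j) v) dc) (τ ∘ suc))
    where
      open Σ (dicolouring-surjective minimal (dicolouring-comap (rootEmbedding G (tower j)) dc) (τ zero))
        renaming (proj₁ to v; proj₂ to root-colour)

open Tower

lemma2p9 : (G : Digraph) (k : ℕ) →
    IsChordalOrientation G → C3toK1Free G → DichromaticNumber G k →
    Σ Digraph (λ F →
    IsChordalOrientation F × C3toK1Free F × DichromaticNumber F k ×
    ((col : Vertex F → Fin k) → IsDicolouring F k col →
    ColourfulTransitiveTournament F k col))
lemma2p9 G k chordalG freeG (dG , minimal) =
  tower G k ,
  tower-chordal G chordalG k ,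
  tower-C3toK1Free G freeG k ,
  (tower-dicolourable G dG k , tower-lowerBound G minimal) ,
  λ col dc → ordered⇒colourful (tower-ordered G minimal k col dc id)
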